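{- Let $K$ be a field of characteristic $r>0$, let $n\ge r$, and let $k\geq1$ be an integer not divisible by $r$. With $p_j=\sum_{i=1}^n x_i^j\in K[x_1,\ldots,x_n]$, we have the strict inclusion $K[p_1,\ldots,p_{k-1}]\subsetneq K[p_1,\ldots,p_k]$. -}

module Defs where

open import Level using (Level; _⊔_)
open import Algebra.Bundles using (CommutativeRing)
open import Data.Nat as ℕ using (ℕ; zero; suc; _<_)
open import Data.Fin using (Fin; zero; suc; toℕ; _≟_)
open import Data.Vec using (Vec; []; _∷_; replicate; zipWith; tabulate; lookup)
open import Data.Vec.Properties using (≡-dec)
open import Data.List using (List; []; _∷_; _++_; map; concatMap; foldr; allFin)
open import Data.Product using (_×_; _,_; ∃; Σ)
open import Relation.Nullary using (¬_; yes; no; Dec)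

record Field (c ℓ : Level) : Set (Level.suc (c ⊔ ℓ)) where
  field
    commutativeRing : CommutativeRing c ℓ
  open CommutativeRing commutativeRing public
  field
    1≉0 : ¬ (1# ≈ 0#)
    inverse : ∀ x → ¬ (x ≈ 0#) → Σ Carrier (λ y → (x * y) ≈ 1#)

module FieldTheory {c ℓ} (K : Field c ℓ) where
  open Field K using (Carrier; _≈_; _+_; _*_; 0#; 1#)

  _·1 : ℕ → Carrier
  zero ·1 = 0#
  suc m ·1 = 1# + (m ·1)

  HasCharacteristic : ℕ → Set ℓ
  HasCharacteristic r = (0 < r) × ((r ·1) ≈ 0#) × (∀ m → 0 < m → m < r → ¬ ((m ·1) ≈ 0#))

  Monomial : ℕ → Set
  Monomial n = Vec ℕ n

  -- Polynomials in K[x_1..x_n], represented as finite formal sums of terms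
  -- c · x^e; two representations denote the same polynomial iff all their
  -- coefficients agree (_≃_ below).
  Poly : ℕ → Set c
  Poly n = List (Carrier × Monomial n)

  coeff : ∀ {n} → Poly n → Monomial n → Carrier
  coeff P m = foldr step 0# P
    where
    step : _ → Carrier → Carrier
    step (c , e) acc with ≡-dec ℕ._≟_ e m
    ... | yes _ = c + acc
    ... | no _ = acc

  _≃_ : ∀ {n} → Poly n → Poly n → Set ℓ
  P ≃ Q = ∀ m → coeff P m ≈ coeff Q m

  _⊕_ : ∀ {n} → Poly n → Poly n → Poly n
  P ⊕ Q = P ++ Q

  _⊗_ : ∀ {n} → Poly n → Poly n → Poly n
  P ⊗ Q = concatMap (λ { (c , e) → map (λ { (d , f) → (c * d , zipWith ℕ._+_ e f) }) Q }) P

  const : ∀ {n} → Carrier → Poly n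
  const a = (a , replicate _ 0) ∷ []

  one : ∀ {n} → Poly n
  one = const 1#

  _^^_ : ∀ {n} → Poly n → ℕ → Poly n
  P ^^ zero = one
  P ^^ suc j = P ⊗ (P ^^ j)

  scale : ∀ {n} → Carrier → Poly n → Poly n
  scale a P = map (λ { (c , e) → (a * c , e) }) P

  prodFin : ∀ {m n} → (Fin m → Poly n) → Poly n
  prodFin {zero} f = one
  prodFin {suc m} f = f zero ⊗ prodFin (λ i → f (suc i))

  subst : ∀ {m n} → Poly m → (Fin m → Poly n) → Poly n
  subst Q g = foldr (λ { (c , e) acc → scale c (prodFin (λ i → g i ^^ lookup e i)) ⊕ acc }) [] Q

  xpow : ∀ {n} → Fin n → ℕ → Monomial n
  xpow i j = tabulate (λ l → helper (i ≟ l))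
    where
    helper : ∀ {A : Set} → Dec A → ℕ
    helper (yes _) = j
    helper (no _) = 0

  powerSum : (n j : ℕ) → Poly n
  powerSum n j = map (λ i → (1# , xpow i j)) (allFin n)

  InPowerSumAlgebra : (n m : ℕ) → Poly n → Set (c ⊔ ℓ)
  InPowerSumAlgebra n m f = Σ (Poly m) (λ Q → subst Q (λ i → powerSum n (ℕ.suc (toℕ i))) ≃ f)

module Submission where

-- Send x₁ ↦ t(1 + ε), x₂, …, x_r ↦ t and the remaining variables to 0 in K[t, ε]/(ε²).
-- Then p_j ↦ (r + jε)tʲ = jεtʲ because r = 0 in K.  The set K ⊕ ε·K[t]_{<k} is closed
-- under sums and products (ε² = 0), so it contains the image of K[p₁, …, p_{k−1}];
-- but p_k ↦ kεtᵏ, and k ≠ 0 in K since r ∤ k.  Reading off the coefficient of εtᵏ is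
-- linear in the coefficients of a polynomial, so it respects the equality _≃_ of
-- representations.

open import Defs
open import Level using (Level; _⊔_)
open import Function using (id; _∘_; _∋_)
open import Data.Empty using (⊥-elim)
open import Data.Nat as ℕ using (ℕ; zero; suc; _≤_; _<_; _∸_; z≤n; s≤s)
import Data.Nat.Properties as ℕₚ
open import Data.Nat.Divisibility using (_∣_; m%n≡0⇒n∣m)
open import Data.Nat.DivMod using (_%_; _/_; m%n<n; m≡m%n+[m/n]*n)
open import Data.Fin using (Fin; zero; suc; toℕ; fromℕ; inject₁; _≟_)
open import Data.Fin.Properties using (suc-injective; toℕ-inject₁; toℕ-fromℕ; toℕ<n)
open import Data.Vec using (Vec; []; _∷_; lookup; replicate; zipWith; _∷ʳ_; _[_]≔_)
open import Data.Vec.Properties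
  using (≡-dec; lookup∘tabulate; lookup-replicate; lookup∘update; lookup∘update′;
         zipWith-identityˡ; zipWith-identityʳ)
open import Data.List as List using (List; []; _∷_; _++_; map)
open import Data.List.Properties using (map-tabulate)
open import Data.Product using (_×_; Σ; _,_)
open import Relation.Binary.PropositionalEquality as ≡ using (_≡_; _≢_; refl; cong; cong₂)
open import Relation.Nullary using (¬_; yes; no)
import Algebra.Properties.CommutativeSemigroup as CommutativeSemigroupProperties

dot : ∀ {n} → (Fin n → ℕ) → Vec ℕ n → ℕ
dot a [] = 0
dot a (x ∷ e) = a zero ℕ.* x ℕ.+ dot (a ∘ suc) e

dot-zipWith-+ : ∀ {n} (a : Fin n → ℕ) (e f : Vec ℕ n) →
                dot a (zipWith ℕ._+_ e f) ≡ dot a e ℕ.+ dot a f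
dot-zipWith-+ a [] [] = refl
dot-zipWith-+ a (x ∷ e) (y ∷ f) = ≡.trans
  (cong₂ ℕ._+_ (ℕₚ.*-distribˡ-+ (a zero) x y) (dot-zipWith-+ (a ∘ suc) e f))
  (CommutativeSemigroupProperties.interchange ℕₚ.+-commutativeSemigroup
    (a zero ℕ.* x) (a zero ℕ.* y) (dot (a ∘ suc) e) (dot (a ∘ suc) f))

dot-zero : ∀ {n} (a : Fin n → ℕ) (e : Vec ℕ n) → (∀ l → lookup e l ≡ 0) → dot a e ≡ 0
dot-zero a [] e≡0 = refl
dot-zero a (x ∷ e) e≡0 = cong₂ ℕ._+_
  (≡.trans (cong (a zero ℕ.*_) (e≡0 zero)) (ℕₚ.*-zeroʳ (a zero)))
  (dot-zero (a ∘ suc) e (e≡0 ∘ suc))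

dot-single : ∀ {n} (a : Fin n → ℕ) (i : Fin n) (e : Vec ℕ n) →
             (∀ l → i ≢ l → lookup e l ≡ 0) → dot a e ≡ a i ℕ.* lookup e i
dot-single a zero (x ∷ e) off = ≡.trans
  (cong (a zero ℕ.* x ℕ.+_) (dot-zero (a ∘ suc) e (λ l → off (suc l) λ ())))
  (ℕₚ.+-identityʳ _)
dot-single a (suc i) (x ∷ e) off = ≡.trans
  (cong (ℕ._+ dot (a ∘ suc) e) (≡.trans (cong (a zero ℕ.*_) (off zero λ ())) (ℕₚ.*-zeroʳ (a zero))))
  (dot-single (a ∘ suc) i e (λ l i≢l → off (suc l) (i≢l ∘ suc-injective)))

onesFrom : ℕ → ∀ {n} → Fin n → ℕ
onesFrom zero i = 1
onesFrom (suc r) zero = 0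
onesFrom (suc r) (suc i) = onesFrom r i

onlyZero : ∀ {n} → Fin n → ℕ
onlyZero zero = 1
onlyZero (suc i) = 0

lookup-∷ʳ-inject₁ : ∀ {A : Set} {m} (e : Vec A m) x i → lookup (e ∷ʳ x) (inject₁ i) ≡ lookup e i
lookup-∷ʳ-inject₁ (y ∷ e) x zero = refl
lookup-∷ʳ-inject₁ (y ∷ e) x (suc i) = lookup-∷ʳ-inject₁ e x i

lookup-∷ʳ-last : ∀ {A : Set} {m} (e : Vec A m) x → lookup (e ∷ʳ x) (fromℕ m) ≡ x
lookup-∷ʳ-last [] x = refl
lookup-∷ʳ-last (y ∷ e) x = lookup-∷ʳ-last e x

module _ {c ℓ} (K : Field c ℓ) where
  open Field K hiding (zero)
    renaming (refl to ≈-refl; sym to ≈-sym; trans to ≈-trans; reflexive to ≈-reflexive)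
  open FieldTheory K
  open import Relation.Binary.Reasoning.Setoid setoid
  open import Algebra.Properties.Ring ring using (-1*x≈-x)
  open import Algebra.Properties.Semiring.Mult semiring
    using (×-homo-+; ×1-homo-*) renaming (_×_ to _·_)
  open import Algebra.Properties.CommutativeMonoid.Sum +-commutativeMonoid
    using (sum-syntax; sum-cong-≋; sum-replicate-zero)
  open CommutativeSemigroupProperties +-commutativeSemigroup
    using (interchange) renaming (x∙yz≈y∙xz to x+yz≈y+xz)
  open CommutativeSemigroupProperties *-commutativeSemigroup
    using () renaming (x∙yz≈y∙xz to x*yz≈y*xz)

  -- Ascribing the type exposes the decision i ≟ l hidden inside xpow to the with.
  lookup-xpow-≡ : ∀ {n} (i : Fin n) j → lookup (xpow i j) i ≡ j
  lookup-xpow-≡ i j with i ≟ i | (lookup (xpow i j) i ≡ _) ∋ lookup∘tabulate _ i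
  ... | yes _ | eq = eq
  ... | no i≢i | _ = ⊥-elim (i≢i refl)

  lookup-xpow-≢ : ∀ {n} (i l : Fin n) j → i ≢ l → lookup (xpow i j) l ≡ 0
  lookup-xpow-≢ i l j i≢l with i ≟ l | (lookup (xpow i j) l ≡ _) ∋ lookup∘tabulate _ l
  ... | yes i≡l | _ = ⊥-elim (i≢l i≡l)
  ... | no _ | eq = eq

  dot-xpow : ∀ {n} (a : Fin n → ℕ) (i : Fin n) j → dot a (xpow i j) ≡ a i ℕ.* j
  dot-xpow a i j = ≡.trans (dot-single a i (xpow i j) (λ l → lookup-xpow-≢ i l j))
                           (cong (a i ℕ.*_) (lookup-xpow-≡ i j))

  ⟦_⟧ : ∀ {n} → Poly n → (Monomial n → Carrier) → Carrier
  ⟦ [] ⟧ w = 0#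
  ⟦ (a , e) ∷ P ⟧ w = a * w e + ⟦ P ⟧ w

  ⟦⟧-++ : ∀ {n} (P Q : Poly n) w → ⟦ P ++ Q ⟧ w ≈ ⟦ P ⟧ w + ⟦ Q ⟧ w
  ⟦⟧-++ [] Q w = ≈-sym (+-identityˡ _)
  ⟦⟧-++ ((a , e) ∷ P) Q w = ≈-trans (+-congˡ (⟦⟧-++ P Q w)) (≈-sym (+-assoc _ _ _))

  ⟦⟧-scale : ∀ {n} b (P : Poly n) w → ⟦ scale b P ⟧ w ≈ b * ⟦ P ⟧ w
  ⟦⟧-scale b [] w = ≈-sym (zeroʳ b)
  ⟦⟧-scale b ((a , e) ∷ P) w =
    ≈-trans (+-cong (*-assoc b a (w e)) (⟦⟧-scale b P w)) (≈-sym (distribˡ b _ _))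

  ⟦⟧-cong : ∀ {n} (P : Poly n) {v w} → (∀ e → v e ≈ w e) → ⟦ P ⟧ v ≈ ⟦ P ⟧ w
  ⟦⟧-cong [] v≈w = ≈-refl
  ⟦⟧-cong ((a , e) ∷ P) v≈w = +-cong (*-congˡ (v≈w e)) (⟦⟧-cong P v≈w)

  ⟦⟧-+ : ∀ {n} (P : Poly n) v w → ⟦ P ⟧ (λ e → v e + w e) ≈ ⟦ P ⟧ v + ⟦ P ⟧ w
  ⟦⟧-+ [] v w = ≈-sym (+-identityˡ 0#)
  ⟦⟧-+ ((a , e) ∷ P) v w =
    ≈-trans (+-cong (distribˡ a (v e) (w e)) (⟦⟧-+ P v w)) (interchange _ _ _ _)

  ⟦⟧-*ˡ : ∀ {n} (P : Poly n) b w → ⟦ P ⟧ (λ e → b * w e) ≈ b * ⟦ P ⟧ w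
  ⟦⟧-*ˡ [] b w = ≈-sym (zeroʳ b)
  ⟦⟧-*ˡ ((a , e) ∷ P) b w = begin
    a * (b * w e) + ⟦ P ⟧ (λ e → b * w e) ≈⟨ +-cong (x*yz≈y*xz a b (w e)) (⟦⟧-*ˡ P b w) ⟩
    b * (a * w e) + b * ⟦ P ⟧ w           ≈⟨ distribˡ b _ _ ⟨
    b * (a * w e + ⟦ P ⟧ w)               ∎

  ⟦⟧-*ʳ : ∀ {n} (P : Poly n) b w → ⟦ P ⟧ (λ e → w e * b) ≈ ⟦ P ⟧ w * b
  ⟦⟧-*ʳ P b w = begin
    ⟦ P ⟧ (λ e → w e * b) ≈⟨ ⟦⟧-cong P (λ e → *-comm (w e) b) ⟩
    ⟦ P ⟧ (λ e → b * w e) ≈⟨ ⟦⟧-*ˡ P b w ⟩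
    b * ⟦ P ⟧ w           ≈⟨ *-comm b _ ⟩
    ⟦ P ⟧ w * b           ∎

  ⟦⟧-⊗ : ∀ {n} (P Q : Poly n) w →
         ⟦ P ⊗ Q ⟧ w ≈ ⟦ P ⟧ (λ e → ⟦ Q ⟧ (λ f → w (zipWith ℕ._+_ e f)))
  ⟦⟧-⊗ [] Q w = ≈-refl
  ⟦⟧-⊗ ((a , e) ∷ P) Q w =
    ≈-trans (⟦⟧-++ (map _ Q) (P ⊗ Q) w) (+-cong (row Q) (⟦⟧-⊗ P Q w))
    where
    row : ∀ R → ⟦ map (λ { (b , f) → (a * b , zipWith ℕ._+_ e f) }) R ⟧ w
              ≈ a * ⟦ R ⟧ (λ f → w (zipWith ℕ._+_ e f))
    row [] = ≈-sym (zeroʳ a)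
    row ((b , f) ∷ R) = ≈-trans (+-cong (*-assoc a b _) (row R)) (≈-sym (distribˡ a _ _))

  ⟦⟧-one : ∀ {n} w → ⟦ one {n} ⟧ w ≈ w (replicate n 0)
  ⟦⟧-one w = ≈-trans (+-identityʳ _) (*-identityˡ _)

  ⟦⟧-powerSum : ∀ n j w → ⟦ powerSum n j ⟧ w ≈ ∑[ l < n ] w (xpow l j)
  ⟦⟧-powerSum n j w = ≈-trans
    (≈-reflexive (cong (λ P → ⟦ P ⟧ w) (map-tabulate {n = n} id (λ i → 1# , xpow i j))))
    (tabulated n)
    where
    tabulated : ∀ m {t : Fin m → Fin n} →
                ⟦ List.tabulate (λ l → 1# , xpow (t l) j) ⟧ w ≈ ∑[ l < m ] w (xpow (t l) j)
    tabulated zero = ≈-refl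
    tabulated (suc m) = +-cong (*-identityˡ _) (tabulated m)

  coeff-++ : ∀ {n} (P Q : Poly n) m → coeff (P ++ Q) m ≈ coeff P m + coeff Q m
  coeff-++ [] Q m = ≈-sym (+-identityˡ _)
  coeff-++ ((a , e) ∷ P) Q m with ≡-dec ℕ._≟_ e m
  ... | yes _ = ≈-trans (+-congˡ (coeff-++ P Q m)) (≈-sym (+-assoc _ _ _))
  ... | no _ = coeff-++ P Q m

  coeff-scale : ∀ {n} b (P : Poly n) m → coeff (scale b P) m ≈ b * coeff P m
  coeff-scale b [] m = ≈-sym (zeroʳ b)
  coeff-scale b ((a , e) ∷ P) m with ≡-dec ℕ._≟_ e m
  ... | yes _ = ≈-trans (+-congˡ (coeff-scale b P m)) (≈-sym (distribˡ b _ _))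
  ... | no _ = coeff-scale b P m

  removeTerms : ∀ {n} → Monomial n → Poly n → Poly n
  removeTerms m [] = []
  removeTerms m ((a , e) ∷ P) with ≡-dec ℕ._≟_ e m
  ... | yes _ = removeTerms m P
  ... | no _ = (a , e) ∷ removeTerms m P

  length-removeTerms : ∀ {n} m (P : Poly n) → List.length (removeTerms m P) ≤ List.length P
  length-removeTerms m [] = z≤n
  length-removeTerms m ((a , e) ∷ P) with ≡-dec ℕ._≟_ e m
  ... | yes _ = ℕₚ.m≤n⇒m≤1+n (length-removeTerms m P)
  ... | no _ = s≤s (length-removeTerms m P)

  length-removeTerms-head : ∀ {n} a e (P : Poly n) →
                            List.length (removeTerms e ((a , e) ∷ P)) ≤ List.length P
  length-removeTerms-head a e P with ≡-dec ℕ._≟_ e e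
  ... | yes _ = length-removeTerms e P
  ... | no e≢e = ⊥-elim (e≢e refl)

  coeff-removeTerms-≡ : ∀ {n} m (P : Poly n) → coeff (removeTerms m P) m ≈ 0#
  coeff-removeTerms-≡ m [] = ≈-refl
  coeff-removeTerms-≡ m ((a , e) ∷ P) with ≡-dec ℕ._≟_ e m
  ... | yes _ = coeff-removeTerms-≡ m P
  ... | no e≢m with ≡-dec ℕ._≟_ e m
  ...   | yes e≡m = ⊥-elim (e≢m e≡m)
  ...   | no _ = coeff-removeTerms-≡ m P

  coeff-removeTerms-≢ : ∀ {n} m (P : Poly n) m′ → m′ ≢ m →
                        coeff (removeTerms m P) m′ ≈ coeff P m′
  coeff-removeTerms-≢ m [] m′ m′≢m = ≈-refl
  coeff-removeTerms-≢ m ((a , e) ∷ P) m′ m′≢m with ≡-dec ℕ._≟_ e m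
  ... | yes refl with ≡-dec ℕ._≟_ e m′
  ...   | yes e≡m′ = ⊥-elim (m′≢m (≡.sym e≡m′))
  ...   | no _ = coeff-removeTerms-≢ m P m′ m′≢m
  coeff-removeTerms-≢ m ((a , e) ∷ P) m′ m′≢m | no _ with ≡-dec ℕ._≟_ e m′
  ...   | yes _ = +-congˡ (coeff-removeTerms-≢ m P m′ m′≢m)
  ...   | no _ = coeff-removeTerms-≢ m P m′ m′≢m

  ⟦⟧-removeTerms : ∀ {n} m (P : Poly n) w →
                   ⟦ P ⟧ w ≈ coeff P m * w m + ⟦ removeTerms m P ⟧ w
  ⟦⟧-removeTerms m [] w = ≈-sym (≈-trans (+-congʳ (zeroˡ (w m))) (+-identityˡ 0#))
  ⟦⟧-removeTerms m ((a , e) ∷ P) w with ≡-dec ℕ._≟_ e m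
  ... | yes refl = begin
    a * w e + ⟦ P ⟧ w                                   ≈⟨ +-congˡ (⟦⟧-removeTerms e P w) ⟩
    a * w e + (coeff P e * w e + ⟦ removeTerms e P ⟧ w) ≈⟨ +-assoc _ _ _ ⟨
    (a * w e + coeff P e * w e) + ⟦ removeTerms e P ⟧ w ≈⟨ +-congʳ (distribʳ (w e) a _) ⟨
    (a + coeff P e) * w e + ⟦ removeTerms e P ⟧ w       ∎
  ... | no _ = ≈-trans (+-congˡ (⟦⟧-removeTerms m P w)) (x+yz≈y+xz _ _ _)

  ⟦⟧-coeff-zero : ∀ {n} (P : Poly n) w → (∀ m → coeff P m ≈ 0#) → ⟦ P ⟧ w ≈ 0#
  ⟦⟧-coeff-zero {n} P w = bounded (List.length P) P ℕₚ.≤-refl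
    where
    bounded : ∀ b (P : Poly n) → List.length P ≤ b → (∀ m → coeff P m ≈ 0#) → ⟦ P ⟧ w ≈ 0#
    bounded b [] _ _ = ≈-refl
    bounded (suc b) P@((a , e) ∷ R) (s≤s |R|≤b) coeff≈0 = begin
      ⟦ P ⟧ w                                  ≈⟨ ⟦⟧-removeTerms e P w ⟩
      coeff P e * w e + ⟦ removeTerms e P ⟧ w  ≈⟨ +-cong head≈0 rest≈0 ⟩
      0# + 0#                                  ≈⟨ +-identityˡ 0# ⟩
      0#                                       ∎
      where
      head≈0 : coeff P e * w e ≈ 0#
      head≈0 = ≈-trans (*-congʳ (coeff≈0 e)) (zeroˡ _)
      removed≈0 : ∀ m → coeff (removeTerms e P) m ≈ 0#
      removed≈0 m with ≡-dec ℕ._≟_ m e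
      ... | yes refl = coeff-removeTerms-≡ m P
      ... | no m≢e = ≈-trans (coeff-removeTerms-≢ e P m m≢e) (coeff≈0 m)
      rest≈0 : ⟦ removeTerms e P ⟧ w ≈ 0#
      rest≈0 = bounded b (removeTerms e P)
                 (ℕₚ.≤-trans (length-removeTerms-head a e R) |R|≤b) removed≈0

  ⟦⟧-resp-≃ : ∀ {n} (P Q : Poly n) w → P ≃ Q → ⟦ P ⟧ w ≈ ⟦ Q ⟧ w
  ⟦⟧-resp-≃ P Q w P≃Q = begin
    ⟦ P ⟧ w                          ≈⟨ +-identityʳ _ ⟨
    ⟦ P ⟧ w + 0#                     ≈⟨ +-congˡ (-‿inverseˡ _) ⟨
    ⟦ P ⟧ w + (- ⟦ Q ⟧ w + ⟦ Q ⟧ w)  ≈⟨ +-assoc _ _ _ ⟨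
    (⟦ P ⟧ w + - ⟦ Q ⟧ w) + ⟦ Q ⟧ w  ≈⟨ +-congʳ difference≈0 ⟩
    0# + ⟦ Q ⟧ w                     ≈⟨ +-identityˡ _ ⟩
    ⟦ Q ⟧ w                          ∎
    where
    D = P ++ scale (- 1#) Q
    coeff-D≈0 : ∀ m → coeff D m ≈ 0#
    coeff-D≈0 m = begin
      coeff D m                             ≈⟨ coeff-++ P _ m ⟩
      coeff P m + coeff (scale (- 1#) Q) m  ≈⟨ +-cong (P≃Q m) (≈-trans (coeff-scale _ Q m) (-1*x≈-x _)) ⟩
      coeff Q m + - coeff Q m               ≈⟨ -‿inverseʳ _ ⟩
      0#                                    ∎
    difference≈0 : ⟦ P ⟧ w + - ⟦ Q ⟧ w ≈ 0#
    difference≈0 = begin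
      ⟦ P ⟧ w + - ⟦ Q ⟧ w             ≈⟨ +-congˡ (≈-trans (⟦⟧-scale (- 1#) Q w) (-1*x≈-x _)) ⟨
      ⟦ P ⟧ w + ⟦ scale (- 1#) Q ⟧ w  ≈⟨ ⟦⟧-++ P _ w ⟨
      ⟦ D ⟧ w                         ≈⟨ ⟦⟧-coeff-zero D w coeff-D≈0 ⟩
      0#                              ∎

  unitAt : ∀ {n} → Monomial n → Monomial n → Carrier
  unitAt m e with ≡-dec ℕ._≟_ e m
  ... | yes _ = 1#
  ... | no _ = 0#

  coeff≈⟦⟧-unitAt : ∀ {n} (P : Poly n) m → coeff P m ≈ ⟦ P ⟧ (unitAt m)
  coeff≈⟦⟧-unitAt [] m = ≈-refl
  coeff≈⟦⟧-unitAt ((a , e) ∷ P) m with ≡-dec ℕ._≟_ e m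
  ... | yes _ = +-cong (≈-sym (*-identityʳ a)) (coeff≈⟦⟧-unitAt P m)
  ... | no _ = ≈-trans (coeff≈⟦⟧-unitAt P m) (≈-sym (≈-trans (+-congʳ (zeroʳ a)) (+-identityˡ _)))

  -- Equivalent to _≃_ (by ≋⇒≃ and ⟦⟧-resp-≃), but visibly a congruence for _⊗_.
  infix 4 _≋_
  record _≋_ {n} (P Q : Poly n) : Set (c ⊔ ℓ) where
    constructor ≋-intro
    field ≋-elim : ∀ w → ⟦ P ⟧ w ≈ ⟦ Q ⟧ w
  open _≋_

  ≋⇒≃ : ∀ {n} {P Q : Poly n} → P ≋ Q → P ≃ Q
  ≋⇒≃ {P = P} {Q} P≋Q m = begin
    coeff P m          ≈⟨ coeff≈⟦⟧-unitAt P m ⟩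
    ⟦ P ⟧ (unitAt m)   ≈⟨ ≋-elim P≋Q (unitAt m) ⟩
    ⟦ Q ⟧ (unitAt m)   ≈⟨ coeff≈⟦⟧-unitAt Q m ⟨
    coeff Q m          ∎

  ≋-refl : ∀ {n} {P : Poly n} → P ≋ P
  ≋-refl = ≋-intro λ w → ≈-refl

  ≋-reflexive : ∀ {n} {P Q : Poly n} → P ≡ Q → P ≋ Q
  ≋-reflexive refl = ≋-refl

  ≋-trans : ∀ {n} {P Q R : Poly n} → P ≋ Q → Q ≋ R → P ≋ R
  ≋-trans P≋Q Q≋R = ≋-intro λ w → ≈-trans (≋-elim P≋Q w) (≋-elim Q≋R w)

  ⊗-cong : ∀ {n} {P P′ Q Q′ : Poly n} → P ≋ P′ → Q ≋ Q′ → P ⊗ Q ≋ P′ ⊗ Q′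
  ⊗-cong {P = P} {P′} {Q} {Q′} P≋P′ Q≋Q′ = ≋-intro λ w → begin
    ⟦ P ⊗ Q ⟧ w                                          ≈⟨ ⟦⟧-⊗ P Q w ⟩
    ⟦ P ⟧ (λ e → ⟦ Q ⟧ (λ f → w (zipWith ℕ._+_ e f)))    ≈⟨ ⟦⟧-cong P (λ e → ≋-elim Q≋Q′ _) ⟩
    ⟦ P ⟧ (λ e → ⟦ Q′ ⟧ (λ f → w (zipWith ℕ._+_ e f)))   ≈⟨ ≋-elim P≋P′ _ ⟩
    ⟦ P′ ⟧ (λ e → ⟦ Q′ ⟧ (λ f → w (zipWith ℕ._+_ e f)))  ≈⟨ ⟦⟧-⊗ P′ Q′ w ⟨
    ⟦ P′ ⊗ Q′ ⟧ w                                        ∎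

  ⊗-identityˡ : ∀ {n} (Q : Poly n) → one ⊗ Q ≋ Q
  ⊗-identityˡ Q = ≋-intro λ w → begin
    ⟦ one ⊗ Q ⟧ w
      ≈⟨ ⟦⟧-⊗ one Q w ⟩
    ⟦ one ⟧ (λ e → ⟦ Q ⟧ (λ f → w (zipWith ℕ._+_ e f)))
      ≈⟨ ⟦⟧-one (λ e → ⟦ Q ⟧ (λ f → w (zipWith ℕ._+_ e f))) ⟩
    ⟦ Q ⟧ (λ f → w (zipWith ℕ._+_ (replicate _ 0) f))
      ≈⟨ ⟦⟧-cong Q (λ f → ≈-reflexive (cong w (zipWith-identityˡ (λ _ → refl) f))) ⟩
    ⟦ Q ⟧ w
      ∎

  ⊗-identityʳ : ∀ {n} (P : Poly n) → P ⊗ one ≋ P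
  ⊗-identityʳ P = ≋-intro λ w → begin
    ⟦ P ⊗ one ⟧ w
      ≈⟨ ⟦⟧-⊗ P one w ⟩
    ⟦ P ⟧ (λ e → ⟦ one ⟧ (λ f → w (zipWith ℕ._+_ e f)))
      ≈⟨ ⟦⟧-cong P (λ e → ⟦⟧-one (λ f → w (zipWith ℕ._+_ e f))) ⟩
    ⟦ P ⟧ (λ e → w (zipWith ℕ._+_ e (replicate _ 0)))
      ≈⟨ ⟦⟧-cong P (λ e → ≈-reflexive (cong w (zipWith-identityʳ ℕₚ.+-identityʳ e))) ⟩
    ⟦ P ⟧ w
      ∎

  ++-cong : ∀ {n} {P P′ Q Q′ : Poly n} → P ≋ P′ → Q ≋ Q′ → P ++ Q ≋ P′ ++ Q′
  ++-cong {P = P} {P′} {Q} {Q′} P≋P′ Q≋Q′ = ≋-intro λ w → begin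
    ⟦ P ++ Q ⟧ w          ≈⟨ ⟦⟧-++ P Q w ⟩
    ⟦ P ⟧ w + ⟦ Q ⟧ w     ≈⟨ +-cong (≋-elim P≋P′ w) (≋-elim Q≋Q′ w) ⟩
    ⟦ P′ ⟧ w + ⟦ Q′ ⟧ w   ≈⟨ ⟦⟧-++ P′ Q′ w ⟨
    ⟦ P′ ++ Q′ ⟧ w        ∎

  scale-cong : ∀ {n} a {P P′ : Poly n} → P ≋ P′ → scale a P ≋ scale a P′
  scale-cong a {P} {P′} P≋P′ = ≋-intro λ w → begin
    ⟦ scale a P ⟧ w   ≈⟨ ⟦⟧-scale a P w ⟩
    a * ⟦ P ⟧ w       ≈⟨ *-congˡ (≋-elim P≋P′ w) ⟩
    a * ⟦ P′ ⟧ w      ≈⟨ ⟦⟧-scale a P′ w ⟨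
    ⟦ scale a P′ ⟧ w  ∎

  prodFin-cong : ∀ {m n} {F G : Fin m → Poly n} → (∀ i → F i ≋ G i) → prodFin F ≋ prodFin G
  prodFin-cong {zero} F≋G = ≋-refl
  prodFin-cong {suc m} F≋G = ⊗-cong (F≋G zero) (prodFin-cong (F≋G ∘ suc))

  prodFin-ones : ∀ {m n} (F : Fin m → Poly n) → (∀ i → F i ≋ one) → prodFin F ≋ one
  prodFin-ones {zero} F F≋one = ≋-refl
  prodFin-ones {suc m} F F≋one =
    ≋-trans (⊗-cong (F≋one zero) (prodFin-ones (F ∘ suc) (F≋one ∘ suc))) (⊗-identityˡ one)

  prodFin-single : ∀ {m n} (F : Fin m → Poly n) l {P} →
                   F l ≋ P → (∀ i → i ≢ l → F i ≋ one) → prodFin F ≋ P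
  prodFin-single F zero {P} Fl≋P others =
    ≋-trans (⊗-cong Fl≋P (prodFin-ones (F ∘ suc) (λ i → others (suc i) λ ()))) (⊗-identityʳ P)
  prodFin-single F (suc l) {P} Fl≋P others =
    ≋-trans (⊗-cong (others zero λ ()) (prodFin-single (F ∘ suc) l Fl≋P others′)) (⊗-identityˡ P)
    where
    others′ : ∀ i → i ≢ l → F (suc i) ≋ one
    others′ i i≢l = others (suc i) (i≢l ∘ suc-injective)

  prodFin-init : ∀ {m n} (F : Fin (suc m) → Poly n) →
                 F (fromℕ m) ≋ one → prodFin F ≋ prodFin (F ∘ inject₁)
  prodFin-init {zero} F Flast≋one = ≋-trans (⊗-cong Flast≋one (≋-refl {P = one})) (⊗-identityˡ one)
  prodFin-init {suc m} F Flast≋one = ⊗-cong (≋-refl {P = F zero}) (prodFin-init (F ∘ suc) Flast≋one)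

  weaken : ∀ {m} → Poly m → Poly (suc m)
  weaken = map (λ { (a , e) → (a , e ∷ʳ 0) })

  subst-weaken : ∀ {m n} (Q : Poly m) (g : Fin (suc m) → Poly n) (h : Fin m → Poly n) →
                 (∀ i → g (inject₁ i) ≡ h i) → subst (weaken Q) g ≋ subst Q h
  subst-weaken [] g h g≡h = ≋-refl
  subst-weaken {m} ((a , e) ∷ Q) g h g≡h =
    ++-cong (scale-cong a (≋-trans (prodFin-init F Flast≋one) (prodFin-cong Finit≋H)))
            (subst-weaken Q g h g≡h)
    where
    F : Fin (suc m) → Poly _
    F i = g i ^^ lookup (e ∷ʳ 0) i
    Flast≋one : F (fromℕ m) ≋ one
    Flast≋one = ≋-reflexive (cong (g (fromℕ m) ^^_) (lookup-∷ʳ-last e 0))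
    Finit≋H : ∀ i → F (inject₁ i) ≋ h i ^^ lookup e i
    Finit≋H i = ≋-reflexive (cong₂ _^^_ (g≡h i) (lookup-∷ʳ-inject₁ e 0 i))

  generators : ∀ n {m} → Fin m → Poly n
  generators n i = powerSum n (suc (toℕ i))

  InPowerSumAlgebra-suc : ∀ n m f → InPowerSumAlgebra n m f → InPowerSumAlgebra n (suc m) f
  InPowerSumAlgebra-suc n m f (Q , Q≃f) = weaken Q , λ e → ≈-trans (≋⇒≃ weakened≋Q e) (Q≃f e)
    where
    weakened≋Q : subst (weaken Q) (generators n) ≋ subst Q (generators n)
    weakened≋Q = subst-weaken Q (generators n) (generators n)
                   (λ i → cong (λ t → powerSum n (suc t)) (toℕ-inject₁ i))

  powerSum∈ : ∀ n m → InPowerSumAlgebra n (suc m) (powerSum n (suc m))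
  powerSum∈ n m = (1# , e) ∷ [] , ≋⇒≃ Q≋p
    where
    e : Monomial (suc m)
    e = replicate (suc m) 0 [ fromℕ m ]≔ 1
    F : Fin (suc m) → Poly n
    F i = generators n i ^^ lookup e i
    Flast≋p : F (fromℕ m) ≋ powerSum n (suc m)
    Flast≋p = ≋-trans
      (≋-reflexive (cong₂ (λ t j → powerSum n (suc t) ^^ j)
                          (toℕ-fromℕ m) (lookup∘update (fromℕ m) (replicate (suc m) 0) 1)))
      (⊗-identityʳ (powerSum n (suc m)))
    others : ∀ i → i ≢ fromℕ m → F i ≋ one
    others i i≢last = ≋-reflexive (cong (generators n i ^^_)
      (≡.trans (lookup∘update′ i≢last (replicate (suc m) 0) 1) (lookup-replicate i 0)))
    Q≋p : subst ((1# , e) ∷ []) (generators n) ≋ powerSum n (suc m)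
    Q≋p = ≋-intro λ w → begin
      ⟦ scale 1# (prodFin F) ++ [] ⟧ w  ≈⟨ ⟦⟧-++ (scale 1# (prodFin F)) [] w ⟩
      ⟦ scale 1# (prodFin F) ⟧ w + 0#   ≈⟨ +-identityʳ _ ⟩
      ⟦ scale 1# (prodFin F) ⟧ w        ≈⟨ ⟦⟧-scale 1# (prodFin F) w ⟩
      1# * ⟦ prodFin F ⟧ w              ≈⟨ *-identityˡ _ ⟩
      ⟦ prodFin F ⟧ w                   ≈⟨ ≋-elim (prodFin-single F (fromℕ m) Flast≋p others) w ⟩
      ⟦ powerSum n (suc m) ⟧ w          ∎

  ·1≈·1# : ∀ m → m ·1 ≈ m · 1#
  ·1≈·1# zero = ≈-refl
  ·1≈·1# (suc m) = +-congˡ (·1≈·1# m)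

  ·1-homo-+ : ∀ m n → (m ℕ.+ n) ·1 ≈ m ·1 + n ·1
  ·1-homo-+ m n = begin
    (m ℕ.+ n) ·1     ≈⟨ ·1≈·1# (m ℕ.+ n) ⟩
    (m ℕ.+ n) · 1#   ≈⟨ ×-homo-+ 1# m n ⟩
    m · 1# + n · 1#  ≈⟨ +-cong (·1≈·1# m) (·1≈·1# n) ⟨
    m ·1 + n ·1      ∎

  ·1-homo-* : ∀ m n → (m ℕ.* n) ·1 ≈ m ·1 * n ·1
  ·1-homo-* m n = begin
    (m ℕ.* n) ·1     ≈⟨ ·1≈·1# (m ℕ.* n) ⟩
    (m ℕ.* n) · 1#   ≈⟨ ×1-homo-* m n ⟩
    m · 1# * n · 1#  ≈⟨ *-cong (·1≈·1# m) (·1≈·1# n) ⟨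
    m ·1 * n ·1      ∎

  ·1≈0⇒≡0 : ∀ {r m} → HasCharacteristic r → m < r → m ·1 ≈ 0# → m ≡ 0
  ·1≈0⇒≡0 {m = zero} _ _ _ = refl
  ·1≈0⇒≡0 {m = suc m} (_ , _ , minimal) m<r m·1≈0 =
    ⊥-elim (minimal (suc m) (s≤s z≤n) m<r m·1≈0)

  characteristic-∣ : ∀ {r k} → HasCharacteristic r → k ·1 ≈ 0# → r ∣ k
  characteristic-∣ {suc r-1} {k} char@(_ , r·1≈0 , _) k·1≈0 =
    m%n≡0⇒n∣m k r (·1≈0⇒≡0 char (m%n<n k r) remainder·1≈0)
    where
    r = suc r-1
    remainder·1≈0 : (k % r) ·1 ≈ 0#
    remainder·1≈0 = begin
      (k % r) ·1                      ≈⟨ +-identityʳ _ ⟨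
      (k % r) ·1 + 0#                 ≈⟨ +-congˡ (zeroʳ _) ⟨
      (k % r) ·1 + (k / r) ·1 * 0#    ≈⟨ +-congˡ (*-congˡ r·1≈0) ⟨
      (k % r) ·1 + (k / r) ·1 * r ·1  ≈⟨ +-congˡ (·1-homo-* (k / r) r) ⟨
      (k % r) ·1 + (k / r ℕ.* r) ·1   ≈⟨ ·1-homo-+ (k % r) _ ⟨
      (k % r ℕ.+ k / r ℕ.* r) ·1      ≈⟨ ≈-reflexive (cong _·1 (m≡m%n+[m/n]*n k r)) ⟨
      k ·1                            ≈⟨ k·1≈0 ⟩
      0#                              ∎

  [_≡0] : ℕ → Carrier
  [ zero ≡0] = 1#
  [ suc h ≡0] = 0#

  -- kronecker x s h = [ x ≡ s ] * [ h ≡0]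
  kronecker : ℕ → ℕ → ℕ → Carrier
  kronecker zero zero h = [ h ≡0]
  kronecker zero (suc s) h = 0#
  kronecker (suc x) zero h = 0#
  kronecker (suc x) (suc s) h = kronecker x s h

  kronecker-≡ : ∀ x h → kronecker x x h ≡ [ h ≡0]
  kronecker-≡ zero h = refl
  kronecker-≡ (suc x) h = kronecker-≡ x h

  kronecker-≢ : ∀ {x s} h → x ≢ s → kronecker x s h ≡ 0#
  kronecker-≢ {zero} {zero} h x≢s = ⊥-elim (x≢s refl)
  kronecker-≢ {zero} {suc s} h x≢s = refl
  kronecker-≢ {suc x} {zero} h x≢s = refl
  kronecker-≢ {suc x} {suc s} h x≢s = kronecker-≢ h (x≢s ∘ cong suc)

  kronecker-suc : ∀ x s h → kronecker x s (suc h) ≡ 0#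
  kronecker-suc zero zero h = refl
  kronecker-suc zero (suc s) h = refl
  kronecker-suc (suc x) zero h = refl
  kronecker-suc (suc x) (suc s) h = kronecker-suc x s h

  kronecker-*-suc : ∀ x s h t → kronecker x s (h ℕ.* suc t) ≡ kronecker x s h
  kronecker-*-suc x s zero t = refl
  kronecker-*-suc x s (suc h) t = ≡.trans (kronecker-suc x s _) (≡.sym (kronecker-suc x s h))

  -- conv s F G = ∑_{a + b = s} F a * G b
  conv : ℕ → (ℕ → Carrier) → (ℕ → Carrier) → Carrier
  conv zero F G = F 0 * G 0
  conv (suc s) F G = F 0 * G (suc s) + conv s (F ∘ suc) G

  conv-zeroˡ : ∀ s {F} G → (∀ a → F a ≈ 0#) → conv s F G ≈ 0#
  conv-zeroˡ zero G F≈0 = ≈-trans (*-congʳ (F≈0 0)) (zeroˡ _)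
  conv-zeroˡ (suc s) G F≈0 = ≈-trans
    (+-cong (≈-trans (*-congʳ (F≈0 0)) (zeroˡ _)) (conv-zeroˡ s G (F≈0 ∘ suc)))
    (+-identityˡ 0#)

  conv-constˡ : ∀ s {F} G → (∀ a → F (suc a) ≈ 0#) → conv s F G ≈ F 0 * G s
  conv-constˡ zero G F≈0 = ≈-refl
  conv-constˡ (suc s) G F≈0 = ≈-trans (+-congˡ (conv-zeroˡ s G F≈0)) (+-identityʳ _)

  conv-constʳ : ∀ s F {G} → (∀ b → G (suc b) ≈ 0#) → conv s F G ≈ F s * G 0
  conv-constʳ zero F G≈0 = ≈-refl
  conv-constʳ (suc s) F G≈0 = ≈-trans
    (+-cong (≈-trans (*-congˡ (G≈0 s)) (zeroʳ _)) (conv-constʳ s (F ∘ suc) G≈0))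
    (+-identityˡ _)

  conv-scaleˡ : ∀ s c F G → c * conv s F G ≈ conv s (λ a → c * F a) G
  conv-scaleˡ zero c F G = ≈-sym (*-assoc c _ _)
  conv-scaleˡ (suc s) c F G =
    ≈-trans (distribˡ c _ _) (+-cong (≈-sym (*-assoc c _ _)) (conv-scaleˡ s c (F ∘ suc) G))

  conv-scaleʳ : ∀ s c F G → c * conv s F G ≈ conv s F (λ b → c * G b)
  conv-scaleʳ zero c F G = x*yz≈y*xz c _ _
  conv-scaleʳ (suc s) c F G =
    ≈-trans (distribˡ c _ _) (+-cong (x*yz≈y*xz c _ _) (conv-scaleʳ s c (F ∘ suc) G))

  ⟦⟧-convˡ : ∀ {n} (P : Poly n) s (F : Monomial n → ℕ → Carrier) G →
             ⟦ P ⟧ (λ e → conv s (F e) G) ≈ conv s (λ a → ⟦ P ⟧ (λ e → F e a)) G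
  ⟦⟧-convˡ P zero F G = ⟦⟧-*ʳ P (G 0) (λ e → F e 0)
  ⟦⟧-convˡ P (suc s) F G = ≈-trans (⟦⟧-+ P _ _)
    (+-cong (⟦⟧-*ʳ P (G (suc s)) (λ e → F e 0)) (⟦⟧-convˡ P s (λ e a → F e (suc a)) G))

  ⟦⟧-convʳ : ∀ {n} (Q : Poly n) s F (G : Monomial n → ℕ → Carrier) →
             ⟦ Q ⟧ (λ f → conv s F (G f)) ≈ conv s F (λ b → ⟦ Q ⟧ (λ f → G f b))
  ⟦⟧-convʳ Q zero F G = ⟦⟧-*ˡ Q (F 0) (λ f → G f 0)
  ⟦⟧-convʳ Q (suc s) F G = ≈-trans (⟦⟧-+ Q _ _)
    (+-cong (⟦⟧-*ˡ Q (F 0) (λ f → G f (suc s))) (⟦⟧-convʳ Q s (F ∘ suc) G))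

  ⟦⟧²-conv : ∀ {n} (P Q : Poly n) s (F G : Monomial n → ℕ → Carrier) →
             ⟦ P ⟧ (λ e → ⟦ Q ⟧ (λ f → conv s (F e) (G f)))
             ≈ conv s (λ a → ⟦ P ⟧ (λ e → F e a)) (λ b → ⟦ Q ⟧ (λ f → G f b))
  ⟦⟧²-conv P Q s F G =
    ≈-trans (⟦⟧-cong P (λ e → ⟦⟧-convʳ Q s (F e) G)) (⟦⟧-convˡ P s F _)

  kronecker-+ : ∀ x x′ s h h′ → kronecker (x ℕ.+ x′) s (h ℕ.+ h′)
                                ≈ conv s (λ a → kronecker x a h) (λ b → kronecker x′ b h′)
  kronecker-+ zero x′ s zero h′ =
    ≈-sym (≈-trans (conv-constˡ s _ (λ _ → ≈-refl)) (*-identityˡ _))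
  kronecker-+ zero x′ s (suc h) h′ = ≈-trans (≈-reflexive (kronecker-suc x′ s (h ℕ.+ h′)))
    (≈-sym (conv-zeroˡ s _ (λ a → ≈-reflexive (kronecker-suc zero a h))))
  kronecker-+ (suc x) x′ zero h h′ = ≈-sym (zeroˡ _)
  kronecker-+ (suc x) x′ (suc s) h h′ =
    ≈-trans (kronecker-+ x x′ s h h′) (≈-sym (≈-trans (+-congʳ (zeroˡ _)) (+-identityˡ _)))

  ∑-zero : ∀ {n} {f : Fin n → Carrier} → (∀ l → f l ≈ 0#) → ∑[ l < n ] f l ≈ 0#
  ∑-zero {n} f≈0 = ≈-trans (sum-cong-≋ f≈0) (sum-replicate-zero n)

  ∑-onesFrom : ∀ {r n} → r ≤ n → ∑[ l < n ] [ onesFrom r l ≡0] ≈ r ·1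
  ∑-onesFrom {zero} {n} _ = sum-replicate-zero n
  ∑-onesFrom {suc r} {suc n} (s≤s r≤n) = +-congˡ (∑-onesFrom r≤n)

  module Specialisation (r : ℕ) where

    degree degreeFrom exponent₀ : ∀ {n} → Monomial n → ℕ
    degree = dot (λ _ → 1)
    degreeFrom = dot (onesFrom r)
    exponent₀ = dot onlyZero

    ω : ∀ {n} → ℕ → Monomial n → Carrier
    ω s e = kronecker (degree e) s (degreeFrom e)

    -- With variables indexed from 0: under x₀ ↦ t(1 + ε), x₁, …, x_{r−1} ↦ t and
    -- x_r, … ↦ 0 into K[t, ε]/(ε²), P is sent to ∑ₛ (ψ s P + δ s P · ε) tˢ.
    ψ δ : ∀ {n} → ℕ → Poly n → Carrier
    ψ s P = ⟦ P ⟧ (ω s)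
    δ s P = ⟦ P ⟧ (λ e → exponent₀ e ·1 * ω s e)

    ω-+ : ∀ {n} s (e f : Monomial n) →
          ω s (zipWith ℕ._+_ e f) ≈ conv s (λ a → ω a e) (λ b → ω b f)
    ω-+ s e f = ≈-trans
      (≈-reflexive (cong₂ (λ x h → kronecker x s h) (dot-zipWith-+ _ e f) (dot-zipWith-+ _ e f)))
      (kronecker-+ (degree e) (degree f) s (degreeFrom e) (degreeFrom f))

    ψ-⊗ : ∀ {n} s (P Q : Poly n) → ψ s (P ⊗ Q) ≈ conv s (λ a → ψ a P) (λ b → ψ b Q)
    ψ-⊗ s P Q = begin
      ψ s (P ⊗ Q)
        ≈⟨ ⟦⟧-⊗ P Q (ω s) ⟩
      ⟦ P ⟧ (λ e → ⟦ Q ⟧ (λ f → ω s (zipWith ℕ._+_ e f)))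
        ≈⟨ ⟦⟧-cong P (λ e → ⟦⟧-cong Q (ω-+ s e)) ⟩
      ⟦ P ⟧ (λ e → ⟦ Q ⟧ (λ f → conv s (λ a → ω a e) (λ b → ω b f)))
        ≈⟨ ⟦⟧²-conv P Q s (λ e a → ω a e) (λ f b → ω b f) ⟩
      conv s (λ a → ψ a P) (λ b → ψ b Q)
        ∎

    δ-⊗ : ∀ {n} s (P Q : Poly n) →
          δ s (P ⊗ Q) ≈ conv s (λ a → δ a P) (λ b → ψ b Q) + conv s (λ a → ψ a P) (λ b → δ b Q)
    δ-⊗ s P Q = begin
      δ s (P ⊗ Q)
        ≈⟨ ⟦⟧-⊗ P Q _ ⟩
      ⟦ P ⟧ (λ e → ⟦ Q ⟧ (λ f → exponent₀ (zipWith ℕ._+_ e f) ·1 * ω s (zipWith ℕ._+_ e f)))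
        ≈⟨ ⟦⟧-cong P (λ e → ≈-trans (⟦⟧-cong Q (leibniz e)) (⟦⟧-+ Q _ _)) ⟩
      ⟦ P ⟧ (λ e → ⟦ Q ⟧ (λ f → conv s (λ a → exponent₀ e ·1 * ω a e) (λ b → ω b f))
                 + ⟦ Q ⟧ (λ f → conv s (λ a → ω a e) (λ b → exponent₀ f ·1 * ω b f)))
        ≈⟨ ≈-trans (⟦⟧-+ P _ _) (+-cong (⟦⟧²-conv P Q s _ _) (⟦⟧²-conv P Q s _ _)) ⟩
      conv s (λ a → δ a P) (λ b → ψ b Q) + conv s (λ a → ψ a P) (λ b → δ b Q)
        ∎
      where
      leibniz : ∀ e f → exponent₀ (zipWith ℕ._+_ e f) ·1 * ω s (zipWith ℕ._+_ e f)
                        ≈ conv s (λ a → exponent₀ e ·1 * ω a e) (λ b → ω b f)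
                          + conv s (λ a → ω a e) (λ b → exponent₀ f ·1 * ω b f)
      leibniz e f = begin
        exponent₀ (zipWith ℕ._+_ e f) ·1 * ω s (zipWith ℕ._+_ e f)
          ≈⟨ *-cong (≈-trans (≈-reflexive (cong _·1 (dot-zipWith-+ _ e f))) (·1-homo-+ uᵉ uᶠ))
                    (ω-+ s e f) ⟩
        (uᵉ ·1 + uᶠ ·1) * conv s ωᵉ ωᶠ
          ≈⟨ distribʳ _ _ _ ⟩
        uᵉ ·1 * conv s ωᵉ ωᶠ + uᶠ ·1 * conv s ωᵉ ωᶠ
          ≈⟨ +-cong (conv-scaleˡ s _ ωᵉ ωᶠ) (conv-scaleʳ s _ ωᵉ ωᶠ) ⟩
        conv s (λ a → uᵉ ·1 * ωᵉ a) ωᶠ + conv s ωᵉ (λ b → uᶠ ·1 * ωᶠ b)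
          ∎
        where
        uᵉ = exponent₀ e
        uᶠ = exponent₀ f
        ωᵉ = λ a → ω a e
        ωᶠ = λ b → ω b f

    -- The image of P in K[t, ε]/(ε²) lies in K ⊕ ε·K[t]_{<k}.
    record LowOrder {n} (k : ℕ) (P : Poly n) : Set ℓ where
      field
        ψ-const : ∀ s → ψ (suc s) P ≈ 0#
        δ-small : ∀ s → k ≤ s → δ s P ≈ 0#
    open LowOrder

    LowOrder-[] : ∀ {n k} → LowOrder {n} k []
    LowOrder-[] = record { ψ-const = λ _ → ≈-refl ; δ-small = λ _ _ → ≈-refl }

    LowOrder-++ : ∀ {n k} {P Q : Poly n} → LowOrder k P → LowOrder k Q → LowOrder k (P ++ Q)
    LowOrder-++ {P = P} {Q} lowP lowQ = record
      { ψ-const = λ s → ≈-trans (⟦⟧-++ P Q _)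
          (≈-trans (+-cong (ψ-const lowP s) (ψ-const lowQ s)) (+-identityˡ 0#))
      ; δ-small = λ s k≤s → ≈-trans (⟦⟧-++ P Q _)
          (≈-trans (+-cong (δ-small lowP s k≤s) (δ-small lowQ s k≤s)) (+-identityˡ 0#))
      }

    LowOrder-scale : ∀ {n k} a {P : Poly n} → LowOrder k P → LowOrder k (scale a P)
    LowOrder-scale a {P} lowP = record
      { ψ-const = λ s → ≈-trans (⟦⟧-scale a P _) (≈-trans (*-congˡ (ψ-const lowP s)) (zeroʳ a))
      ; δ-small = λ s k≤s →
          ≈-trans (⟦⟧-scale a P _) (≈-trans (*-congˡ (δ-small lowP s k≤s)) (zeroʳ a))
      }

    LowOrder-one : ∀ {n k} → LowOrder {n} k one
    LowOrder-one {n} = record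
      { ψ-const = λ s → ≈-trans (⟦⟧-one {n} (ω (suc s)))
          (≈-reflexive (cong (λ x → kronecker x (suc s) (degreeFrom (replicate n 0))) degree-0))
      ; δ-small = λ s _ → ≈-trans (⟦⟧-one {n} (λ e → exponent₀ e ·1 * ω s e))
          (≈-trans (*-congʳ (≈-reflexive (cong _·1 exponent₀-0))) (zeroˡ _))
      }
      where
      zeros : ∀ l → lookup (replicate n 0) l ≡ 0
      zeros l = lookup-replicate l 0
      degree-0 : degree (replicate n 0) ≡ 0
      degree-0 = dot-zero (λ _ → 1) (replicate n 0) zeros
      exponent₀-0 : exponent₀ (replicate n 0) ≡ 0
      exponent₀-0 = dot-zero onlyZero (replicate n 0) zeros

    LowOrder-⊗ : ∀ {n k} {P Q : Poly n} → LowOrder k P → LowOrder k Q → LowOrder k (P ⊗ Q)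
    LowOrder-⊗ {P = P} {Q} lowP lowQ = record
      { ψ-const = λ s → begin
          ψ (suc s) (P ⊗ Q)                         ≈⟨ ψ-⊗ (suc s) P Q ⟩
          conv (suc s) (λ a → ψ a P) (λ b → ψ b Q)  ≈⟨ conv-constˡ (suc s) {ψ′ P} _ (ψ-const lowP) ⟩
          ψ 0 P * ψ (suc s) Q                       ≈⟨ *-congˡ (ψ-const lowQ s) ⟩
          ψ 0 P * 0#                                ≈⟨ zeroʳ _ ⟩
          0#                                        ∎
      ; δ-small = λ s k≤s → begin
          δ s (P ⊗ Q)
            ≈⟨ δ-⊗ s P Q ⟩
          conv s (λ a → δ a P) (λ b → ψ b Q) + conv s (λ a → ψ a P) (λ b → δ b Q)
            ≈⟨ +-cong (conv-constʳ s _ {ψ′ Q} (ψ-const lowQ)) (conv-constˡ s {ψ′ P} _ (ψ-const lowP)) ⟩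
          δ s P * ψ 0 Q + ψ 0 P * δ s Q
            ≈⟨ +-cong (*-congʳ (δ-small lowP s k≤s)) (*-congˡ (δ-small lowQ s k≤s)) ⟩
          0# * ψ 0 Q + ψ 0 P * 0#
            ≈⟨ ≈-trans (+-cong (zeroˡ _) (zeroʳ _)) (+-identityˡ 0#) ⟩
          0#
            ∎
      }
      where
      ψ′ : Poly _ → ℕ → Carrier
      ψ′ R a = ψ a R

    LowOrder-^^ : ∀ {n k} {P : Poly n} j → LowOrder k P → LowOrder k (P ^^ j)
    LowOrder-^^ zero lowP = LowOrder-one
    LowOrder-^^ (suc j) lowP = LowOrder-⊗ lowP (LowOrder-^^ j lowP)

    LowOrder-prodFin : ∀ {m n k} (F : Fin m → Poly n) →
                       (∀ i → LowOrder k (F i)) → LowOrder k (prodFin F)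
    LowOrder-prodFin {zero} F lowF = LowOrder-one
    LowOrder-prodFin {suc m} F lowF =
      LowOrder-⊗ (lowF zero) (LowOrder-prodFin (F ∘ suc) (lowF ∘ suc))

    LowOrder-subst : ∀ {m n k} (Q : Poly m) (g : Fin m → Poly n) →
                     (∀ i → LowOrder k (g i)) → LowOrder k (subst Q g)
    LowOrder-subst [] g lowg = LowOrder-[]
    LowOrder-subst ((a , e) ∷ Q) g lowg = LowOrder-++
      (LowOrder-scale a (LowOrder-prodFin _ (λ i → LowOrder-^^ (lookup e i) (lowg i))))
      (LowOrder-subst Q g lowg)

    ω-xpow : ∀ {n} s (l : Fin n) j → ω s (xpow l j) ≡ kronecker j s (onesFrom r l ℕ.* j)
    ω-xpow s l j = cong₂ (λ x h → kronecker x s h)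
      (≡.trans (dot-xpow _ l j) (ℕₚ.*-identityˡ j)) (dot-xpow _ l j)

    ψ-powerSum : ∀ n s t →
                 ψ s (powerSum n (suc t)) ≈ ∑[ l < n ] kronecker (suc t) s (onesFrom r l)
    ψ-powerSum n s t = ≈-trans (⟦⟧-powerSum n (suc t) (ω s)) (sum-cong-≋ {n} λ l →
      ≈-reflexive (≡.trans (ω-xpow s l (suc t)) (kronecker-*-suc (suc t) s (onesFrom r l) t)))

    δ-powerSum : ∀ n s j → δ s (powerSum n j)
                 ≈ ∑[ l < n ] ((onlyZero l ℕ.* j) ·1 * kronecker j s (onesFrom r l ℕ.* j))
    δ-powerSum n s j = ≈-trans (⟦⟧-powerSum n j _) (sum-cong-≋ {n} λ l →
      ≈-reflexive (cong₂ (λ x y → x ·1 * y) (dot-xpow onlyZero l j) (ω-xpow s l j)))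

    LowOrder-powerSum : ∀ {n k} → r ·1 ≈ 0# → r ≤ n → ∀ t → suc t < k →
                        LowOrder k (powerSum n (suc t))
    LowOrder-powerSum {n} r·1≈0 r≤n t t<k = record
      { ψ-const = λ s → ≈-trans (ψ-powerSum n (suc s) t) (diagonal s)
      ; δ-small = λ s k≤s → ≈-trans (δ-powerSum n s (suc t)) (∑-zero {n} λ l →
          ≈-trans (*-congˡ (≈-reflexive (kronecker-≢ (onesFrom r l ℕ.* suc t) (t<s k≤s))))
                  (zeroʳ _))
      }
      where
      t<s : ∀ {s} → _ ≤ s → suc t ≢ s
      t<s k≤s refl = ℕₚ.<⇒≱ t<k k≤s
      diagonal : ∀ s → ∑[ l < n ] kronecker t s (onesFrom r l) ≈ 0#
      diagonal s with t ℕ.≟ s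
      ... | yes refl = ≈-trans (sum-cong-≋ {n} λ l → ≈-reflexive (kronecker-≡ t (onesFrom r l)))
                               (≈-trans (∑-onesFrom r≤n) r·1≈0)
      ... | no t≢s = ∑-zero {n} λ l → ≈-reflexive (kronecker-≢ (onesFrom r l) t≢s)

    δ-powerSum-diagonal : ∀ {n} → 1 ≤ r → r ≤ n → ∀ k → δ k (powerSum n k) ≈ k ·1
    δ-powerSum-diagonal {suc n} (s≤s z≤n) _ k = begin
      δ k (powerSum (suc n) k)
        ≈⟨ δ-powerSum (suc n) k k ⟩
      (1 ℕ.* k) ·1 * kronecker k k 0
        + ∑[ l < n ] ((0 ℕ.* k) ·1 * kronecker k k (onesFrom r (suc l) ℕ.* k))
        ≈⟨ +-cong (*-cong (≈-reflexive (cong _·1 (ℕₚ.*-identityˡ k))) (≈-reflexive (kronecker-≡ k 0)))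
                  (∑-zero {n} λ l → zeroˡ _) ⟩
      k ·1 * 1# + 0#
        ≈⟨ ≈-trans (+-identityʳ _) (*-identityʳ _) ⟩
      k ·1
        ∎

  powerSum∉ : ∀ {r n m} → HasCharacteristic r → r ≤ n → ¬ r ∣ suc m →
              ¬ InPowerSumAlgebra n m (powerSum n (suc m))
  powerSum∉ {r} {n} {m} char@(0<r , r·1≈0 , _) r≤n r∤k (Q , Q≃p) =
    r∤k (characteristic-∣ char (begin
      suc m ·1                            ≈⟨ δ-powerSum-diagonal 0<r r≤n (suc m) ⟨
      δ (suc m) (powerSum n (suc m))      ≈⟨ ⟦⟧-resp-≃ (subst Q (generators n)) (powerSum n (suc m)) _ Q≃p ⟨
      δ (suc m) (subst Q (generators n))  ≈⟨ LowOrder.δ-small lowOrder (suc m) ℕₚ.≤-refl ⟩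
      0#                                  ∎))
    where
    open Specialisation r
    lowOrder : LowOrder (suc m) (subst Q (generators n))
    lowOrder = LowOrder-subst Q (generators n)
                 (λ i → LowOrder-powerSum r·1≈0 r≤n (toℕ i) (s≤s (toℕ<n i)))

proposition3p3 : ∀ {c ℓ : Level} (K : Field c ℓ) (r n k : ℕ) →
    FieldTheory.HasCharacteristic K r → r ≤ n → 1 ≤ k → ¬ (r ∣ k) →
    let open FieldTheory K in
    ((f : Poly n) → InPowerSumAlgebra n (k ∸ 1) f → InPowerSumAlgebra n k f)
    × Σ (Poly n) (λ f → InPowerSumAlgebra n k f × ¬ InPowerSumAlgebra n (k ∸ 1) f)
proposition3p3 K r n (suc m) char r≤n (s≤s z≤n) r∤k =
  InPowerSumAlgebra-suc K n m ,
  (FieldTheory.powerSum K n (suc m) , powerSum∈ K n m , powerSum∉ K char r≤n r∤k)
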